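{- Let $NC$ be an initial neuronal circuit satisfying $\mathit{ContraInhib}(NC)$, with neurons $N_0,N_1$ (identifiers $0,1$). Let $\mathit{inp}$ be a list of external input functions such that every $b\in\mathit{inp}$ satisfies $b(2)=1$ and $b(3)=1$. Assume $w_{N_0}(1)+w_{N_0}(2)\ge\tau_{N_0}$, $w_{N_1}(3)\ge\tau_{N_1}$ and $w_{N_1}(0)+w_{N_1}(3)\le 0$. Then $output_{NC}(N_0,\mathit{inp})=\mathit{repeat}(1,|\mathit{inp}|)\mathbin{++}[0]$, and $output_{NC}(N_1,\mathit{inp})=[0]$ if $|\mathit{inp}|=0$, while $output_{NC}(N_1,\mathit{inp})=\mathit{repeat}(0,|\mathit{inp}|-1)\mathbin{++}[1;0]$ otherwise.
   Context: Booleans are identified with $0$ (false) and $1$ (true). A neuron $N$ consists of an identifier $id_N\in\mathbb{N}$, a weight function $w_N:\mathbb{N}\to\mathbb{Q}$ with $-1\le w_N(x)\le 1$ for all $x$ and $w_N(id_N)=0$, a leak factor $lk_N\in\mathbb{Q}$ with $0\le lk_N\le 1$, a threshold $\tau_N\in\mathbb{Q}$ with $\tau_N>0$, an output list $Output(N)$ of booleans (most recent first) and a current potential $CurPot(N)\in\mathbb{Q}$, subject to: $(\tau_N\le CurPot(N))$ equals the head of $Output(N)$ (the head of an empty list being $0$). An input function is a map $i:\mathbb{N}\to\{0,1\}$; $potential(w,i,len)=\sum_{0\le k<len,\ i(k)=1} w(k)$. The one-step update of $N$ with input function $i$ in an environment of $len$ neurons keeps $id,w,lk,\tau$, sets the new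 potential $p=potential(w_N,i,len)$ if $\tau_N\le CurPot(N)$ and $p=potential(w_N,i,len)+lk_N\cdot CurPot(N)$ otherwise, and sets the new output list to $(\tau_N\le p)::Output(N)$. A neuron is initial if its output list is $[0]$ and its current potential is $0$. A neuronal circuit $NC$ consists of a time $t_{NC}$, a list $ln_{NC}$ of neurons with pairwise distinct identifiers all $<|ln_{NC}|$ and all output lists of length $t_{NC}+1$, and a number $si_{NC}$ of external sources, with identifiers $|ln_{NC}|,\dots,L-1$, $L=|ln_{NC}|+si_{NC}$. One step of $NC$ on an external input function $e:\mathbb{N}\to\{0,1\}$ replaces each neuron $N$ by its one-step update in an environment of $L$ neurons with input function $x\mapsto$ (head of the output list, before the step, of the circuit neuron with identifier $x$ if $x<|ln_{NC}|$; $e(x)$ otherwise), and increments the time. A list of external input functions (most recent first) is processed from its last element to its first. $output_{NC}(N,\mathit{inp})$ is the output list of the neuron with identifier $id_N$ after processing $\mathit{inp}$. $NC$ is initial if all its neurons are initial. $\mathit{ContraInhib}(NC)$ means: $si_{NC}=2$, $|ln_{NC}|=2$, the neuron with identifier $0$ has $w(1)<0$, $w(2)>0$, $w(3)=0$, and the neuron with identifier $1$ has $w(0)<0$, $w(2)=0$, $w(3)>0$ (external sources have identifiers $2$ and $3$). $\mathbin{++}$ is concatenation; $\mathit{repeat}(v,k)$ is the list of $k$ copies of $v$. -}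

module Defs where

open import Data.Nat as ℕ using (ℕ; zero; suc; _≟_)
open import Data.Bool using (Bool; true; false; if_then_else_)
open import Data.List using (List; []; _∷_; length; map; foldr; upTo)
open import Data.List.Relation.Unary.All using (All)
open import Data.List.Relation.Unary.AllPairs using (AllPairs)
open import Data.Rational as ℚ using (ℚ; 0ℚ; 1ℚ; _+_; _*_; _≤_; _<_; _≤ᵇ_; -_)
open import Relation.Nullary using (¬_; yes; no)
open import Relation.Binary.PropositionalEquality using (_≡_)
import Data.Maybe
open import Data.Product using (_×_; ∃-syntax; _,_)

headB : List Bool → Bool
headB []      = false
headB (b ∷ _) = b

record Neuron : Set where
  constructor mkNeuron
  field
    nid    : ℕ
    w      : ℕ → ℚ
    lk     : ℚ
    τ      : ℚ
    output : List Bool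
    curPot : ℚ
open Neuron public

record ValidNeuron (N : Neuron) : Set where
  field
    w-lower  : ∀ x → - 1ℚ ≤ w N x
    w-upper  : ∀ x → w N x ≤ 1ℚ
    w-self   : w N (nid N) ≡ 0ℚ
    lk-lower : 0ℚ ≤ lk N
    lk-upper : lk N ≤ 1ℚ
    τ-pos    : 0ℚ < τ N
    out-pot  : (τ N ≤ᵇ curPot N) ≡ headB (output N)

InputFn : Set
InputFn = ℕ → Bool

potential : (ℕ → ℚ) → InputFn → ℕ → ℚ
potential w i len = foldr (λ k acc → (if i k then w k else 0ℚ) + acc) 0ℚ (upTo len)

nextPot : Neuron → InputFn → ℕ → ℚ
nextPot N i len =
  if τ N ≤ᵇ curPot N
  then potential (w N) i len
  else potential (w N) i len + lk N * curPot N

neuronStep : Neuron → InputFn → ℕ → Neuron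
neuronStep N i len = record N
  { output = (τ N ≤ᵇ nextPot N i len) ∷ output N
  ; curPot = nextPot N i len
  }

InitialNeuron : Neuron → Set
InitialNeuron N = (output N ≡ false ∷ []) × (curPot N ≡ 0ℚ)

record Circuit : Set where
  constructor mkCircuit
  field
    time : ℕ
    ln   : List Neuron
    si   : ℕ
open Circuit public

record ValidCircuit (NC : Circuit) : Set where
  field
    neurons-valid : All ValidNeuron (ln NC)
    ids-distinct  : AllPairs (λ M N → ¬ (nid M ≡ nid N)) (ln NC)
    ids-bound     : All (λ N → nid N ℕ.< length (ln NC)) (ln NC)
    out-length    : All (λ N → length (output N) ≡ suc (time NC)) (ln NC)

-- the neuron with a given identifier (first match; unique under ValidCircuit)
findNeuron : ℕ → List Neuron → Data.Maybe.Maybe Neuron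
findNeuron x []       = Data.Maybe.nothing
findNeuron x (N ∷ ns) with nid N ≟ x
... | yes _ = Data.Maybe.just N
... | no  _ = findNeuron x ns

headOutputOf : ℕ → List Neuron → Bool
headOutputOf x ns = Data.Maybe.maybe (λ N → headB (output N)) false (findNeuron x ns)

circuitInput : Circuit → InputFn → InputFn
circuitInput NC e x with x ℕ.<? length (ln NC)
... | yes _ = headOutputOf x (ln NC)
... | no  _ = e x

circuitStep : Circuit → InputFn → Circuit
circuitStep NC e = record NC
  { time = suc (time NC)
  ; ln   = map (λ N → neuronStep N (circuitInput NC e) (length (ln NC) ℕ.+ si NC)) (ln NC)
  }

-- process a list of external inputs (most recent first): last element first
run : Circuit → List InputFn → Circuit
run NC []       = NC
run NC (e ∷ es) = circuitStep (run NC es) e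

outputOf : Circuit → ℕ → List InputFn → List Bool
outputOf NC x inp = Data.Maybe.maybe output [] (findNeuron x (ln (run NC inp)))

InitialCircuit : Circuit → Set
InitialCircuit NC = All InitialNeuron (ln NC)

ContraInhib : Circuit → Set
ContraInhib NC =
  (si NC ≡ 2) × (length (ln NC) ≡ 2) ×
  (∃[ N₀ ] (findNeuron 0 (ln NC) ≡ Data.Maybe.just N₀ ×
      w N₀ 1 < 0ℚ × 0ℚ < w N₀ 2 × w N₀ 3 ≡ 0ℚ)) ×
  (∃[ N₁ ] (findNeuron 1 (ln NC) ≡ Data.Maybe.just N₁ ×
      w N₁ 0 < 0ℚ × w N₁ 2 ≡ 0ℚ × 0ℚ < w N₁ 3))

repeat : {A : Set} → A → ℕ → List A
repeat v zero    = []
repeat v (suc k) = v ∷ repeat v k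

{-# OPTIONS --safe #-}
-- N₀ reaches its threshold at every step: source 2 always contributes w₀(2), the only other input
-- reaching it is the inhibition w₀(1) ≤ 0 from N₁, w₀(1) + w₀(2) ≥ τ₀, and a nonnegative leftover
-- potential only helps. At the first step N₀ is still silent, so N₁ receives only w₁(3) ≥ τ₁ and fires.
-- From then on N₀ fires at every step, so N₁ receives w₁(0) + w₁(3) ≤ 0; after its own firing its
-- potential is reset, and leaking a nonpositive potential cannot make it positive, so N₁ stays silent.
module Submission where

open import Defs
open import Data.Nat using (ℕ; zero; suc; _∸_)
open import Data.Bool using (Bool; true; false)
open import Data.List using (List; []; _∷_; length; _++_)
open import Data.List.Relation.Unary.All using (All)
open import Data.Maybe using (just)
open import Data.Rational using (ℚ; 0ℚ; _+_; _≤_)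
open import Relation.Binary.PropositionalEquality using (_≡_; _≢_)
open import Data.Product using (_×_)

import Data.Nat as ℕ
import Data.Nat.Properties as ℕ
open import Data.Nat using (_≟_; _<?_)
open import Data.Bool using (if_then_else_)
open import Data.Bool.Properties using (T-≡)
open import Data.Empty using (⊥-elim)
open import Data.List using (map)
open import Data.List.Properties using (length-map)
open import Data.List.Membership.Propositional using (_∈_)
open import Data.List.Relation.Unary.All using ([]; _∷_; lookup)
open import Data.List.Relation.Unary.Any using (here; there)
open import Data.Maybe using (maybe)
import Data.Maybe as Maybe
open import Data.Maybe.Properties using (just-injective)
open import Data.Product using (_,_)
open import Data.Rational using (_<_; _*_; _≤ᵇ_; nonNegative; nonPositive)
open import Data.Rational.Properties
  using (≤ᵇ⇒≤; ≤⇒≤ᵇ; ≤-<-trans; <-≤-trans; <-irrefl; ≤-refl; <⇒≤; +-identityˡ; +-identityʳ;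
         +-monoˡ-≤; +-monoʳ-≤; nonNegative⁻¹; nonPositive⁻¹; nonNeg*nonNeg⇒nonNeg; nonNeg*nonPos⇒nonPos;
         module ≤-Reasoning)
open import Function using (_∘_)
open import Function.Bundles using (Equivalence)
open import Relation.Nullary using (yes; no)
open import Relation.Binary.PropositionalEquality using (refl; sym; trans; cong; cong₂; subst; module ≡-Reasoning)

≤⇒≤ᵇ≡true : ∀ {p q} → p ≤ q → (p ≤ᵇ q) ≡ true
≤⇒≤ᵇ≡true = Equivalence.to T-≡ ∘ ≤⇒≤ᵇ

>⇒≤ᵇ≡false : ∀ {p q} → q < p → (p ≤ᵇ q) ≡ false
>⇒≤ᵇ≡false {p} {q} q<p with p ≤ᵇ q in p≤ᵇq
... | false = refl
... | true  = ⊥-elim (<-irrefl refl (≤-<-trans (≤ᵇ⇒≤ (Equivalence.from T-≡ p≤ᵇq)) q<p))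

contribution : (ℕ → ℚ) → InputFn → ℕ → ℚ
contribution w i k = if i k then w k else 0ℚ

contribution-on : ∀ w i k → i k ≡ true → contribution w i k ≡ w k
contribution-on w i k = cong (λ b → if b then w k else 0ℚ)

contribution-silent : ∀ w i k → w k ≡ 0ℚ → contribution w i k ≡ 0ℚ
contribution-silent w i k wk≡0 with i k
... | true  = wk≡0
... | false = refl

weight≤contribution : ∀ w i k → w k ≤ 0ℚ → w k ≤ contribution w i k
weight≤contribution w i k wk≤0 with i k
... | true  = ≤-refl
... | false = wk≤0

module _ (w : ℕ → ℚ) (i : InputFn) where
  open ≡-Reasoning

  potential₄-inner : contribution w i 0 ≡ 0ℚ → contribution w i 3 ≡ 0ℚ →
    potential w i 4 ≡ contribution w i 1 + contribution w i 2
  potential₄-inner c₀≡0 c₃≡0 = begin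
    potential w i 4                            ≡⟨ cong₂ (λ x y → x + (c₁ + (c₂ + (y + 0ℚ)))) c₀≡0 c₃≡0 ⟩
    0ℚ + (c₁ + (c₂ + (0ℚ + 0ℚ)))               ≡⟨ +-identityˡ _ ⟩
    c₁ + (c₂ + 0ℚ)                             ≡⟨ cong (c₁ +_) (+-identityʳ c₂) ⟩
    c₁ + c₂                                    ∎
    where
    c₁ = contribution w i 1
    c₂ = contribution w i 2

  potential₄-outer : contribution w i 1 ≡ 0ℚ → contribution w i 2 ≡ 0ℚ →
    potential w i 4 ≡ contribution w i 0 + contribution w i 3
  potential₄-outer c₁≡0 c₂≡0 = begin
    potential w i 4                            ≡⟨ cong₂ (λ x y → c₀ + (x + (y + (c₃ + 0ℚ)))) c₁≡0 c₂≡0 ⟩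
    c₀ + (0ℚ + (0ℚ + (c₃ + 0ℚ)))               ≡⟨ cong (c₀ +_) (trans (+-identityˡ _) (+-identityˡ _)) ⟩
    c₀ + (c₃ + 0ℚ)                             ≡⟨ cong (c₀ +_) (+-identityʳ c₃) ⟩
    c₀ + c₃                                    ∎
    where
    c₀ = contribution w i 0
    c₃ = contribution w i 3

module _ (N : Neuron) (i : InputFn) (len : ℕ) where

  nextPot-fired : τ N ≤ curPot N → nextPot N i len ≡ potential (w N) i len
  nextPot-fired τ≤p =
    cong (λ b → if b then potential (w N) i len else potential (w N) i len + lk N * curPot N) (≤⇒≤ᵇ≡true τ≤p)

  potential≤nextPot : 0ℚ ≤ lk N → 0ℚ ≤ curPot N → potential (w N) i len ≤ nextPot N i len
  potential≤nextPot 0≤lk 0≤p with τ N ≤ᵇ curPot N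
  ... | true  = ≤-refl
  ... | false = subst (_≤ potential (w N) i len + lk N * curPot N) (+-identityʳ _)
                  (+-monoʳ-≤ (potential (w N) i len) 0≤lk*p)
    where
    0≤lk*p : 0ℚ ≤ lk N * curPot N
    0≤lk*p = nonNegative⁻¹ _ {{nonNeg*nonNeg⇒nonNeg (lk N) {{nonNegative 0≤lk}} (curPot N) {{nonNegative 0≤p}}}}

  nextPot≤potential : 0ℚ ≤ lk N → curPot N ≤ 0ℚ → nextPot N i len ≤ potential (w N) i len
  nextPot≤potential 0≤lk p≤0 with τ N ≤ᵇ curPot N
  ... | true  = ≤-refl
  ... | false = subst (potential (w N) i len + lk N * curPot N ≤_) (+-identityʳ _)
                  (+-monoʳ-≤ (potential (w N) i len) lk*p≤0)
    where
    lk*p≤0 : lk N * curPot N ≤ 0ℚ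
    lk*p≤0 = nonPositive⁻¹ _ {{nonNeg*nonPos⇒nonPos (lk N) {{nonNegative 0≤lk}} (curPot N) {{nonPositive p≤0}}}}

findNeuron-nid : ∀ {x N} ns → findNeuron x ns ≡ just N → nid N ≡ x
findNeuron-nid {x} (M ∷ ns) found with nid M ≟ x
... | yes nidM≡x = trans (cong nid (sym (just-injective found))) nidM≡x
... | no  _      = findNeuron-nid ns found

findNeuron-∈ : ∀ {x N} ns → findNeuron x ns ≡ just N → N ∈ ns
findNeuron-∈ {x} (M ∷ ns) found with nid M ≟ x
... | yes _ = here (sym (just-injective found))
... | no  _ = there (findNeuron-∈ ns found)

findNeuron-map-neuronStep : ∀ x i len ns →
  findNeuron x (map (λ N → neuronStep N i len) ns) ≡ Maybe.map (λ N → neuronStep N i len) (findNeuron x ns)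
findNeuron-map-neuronStep x i len []       = refl
findNeuron-map-neuronStep x i len (N ∷ ns) with nid N ≟ x
... | yes _ = refl
... | no  _ = findNeuron-map-neuronStep x i len ns

length-ln-run : ∀ NC es → length (ln (run NC es)) ≡ length (ln NC)
length-ln-run NC []       = refl
length-ln-run NC (e ∷ es) = trans (length-map _ (ln (run NC es))) (length-ln-run NC es)

si-run : ∀ NC es → si (run NC es) ≡ si NC
si-run NC []       = refl
si-run NC (e ∷ es) = si-run NC es

module _ (C : Circuit) (e : InputFn) where

  findNeuron-circuitStep : ∀ {x N L} → length (ln C) ℕ.+ si C ≡ L → findNeuron x (ln C) ≡ just N →
    findNeuron x (ln (circuitStep C e)) ≡ just (neuronStep N (circuitInput C e) L)
  findNeuron-circuitStep {x} refl found =
    trans (findNeuron-map-neuronStep x (circuitInput C e) (length (ln C) ℕ.+ si C) (ln C))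
          (cong (Maybe.map (λ M → neuronStep M (circuitInput C e) (length (ln C) ℕ.+ si C))) found)

  circuitInput-neuron : ∀ {x N} → x ℕ.< length (ln C) → findNeuron x (ln C) ≡ just N →
    circuitInput C e x ≡ headB (output N)
  circuitInput-neuron {x} x<len found with x <? length (ln C)
  ... | yes _    = cong (maybe (headB ∘ output) false) found
  ... | no  x≮len = ⊥-elim (x≮len x<len)

  circuitInput-source : ∀ {x} → length (ln C) ℕ.≤ x → circuitInput C e x ≡ e x
  circuitInput-source {x} len≤x with x <? length (ln C)
  ... | yes x<len = ⊥-elim (ℕ.<⇒≱ x<len len≤x)
  ... | no  _     = refl

withState : Neuron → List Bool → ℚ → Neuron
withState N o p = record N { output = o ; curPot = p }

firesAlways : ℕ → List Bool
firesAlways n = repeat true n ++ false ∷ []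

firesOnce : ℕ → List Bool
firesOnce zero    = false ∷ []
firesOnce (suc n) = repeat false n ++ true ∷ false ∷ []

firesOnce-nonzero : ∀ n → n ≢ 0 → firesOnce n ≡ repeat false (n ∸ 1) ++ true ∷ false ∷ []
firesOnce-nonzero zero    n≢0 = ⊥-elim (n≢0 refl)
firesOnce-nonzero (suc n) _   = refl

module ContraInhibition
  (N₀ N₁ : Neuron) (valid₀ : ValidNeuron N₀) (valid₁ : ValidNeuron N₁) (nid₀ : nid N₀ ≡ 0) (nid₁ : nid N₁ ≡ 1)
  (w₀₁≤0 : w N₀ 1 ≤ 0ℚ) (w₀₃≡0 : w N₀ 3 ≡ 0ℚ) (w₁₂≡0 : w N₁ 2 ≡ 0ℚ)
  (τ₀≤w₀₁+w₀₂ : τ N₀ ≤ w N₀ 1 + w N₀ 2) (τ₁≤w₁₃ : τ N₁ ≤ w N₁ 3) (w₁₀+w₁₃≤0 : w N₁ 0 + w N₁ 3 ≤ 0ℚ)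
  where

  open ValidNeuron

  w₀₀≡0 : w N₀ 0 ≡ 0ℚ
  w₀₀≡0 = subst (λ k → w N₀ k ≡ 0ℚ) nid₀ (w-self valid₀)

  w₁₁≡0 : w N₁ 1 ≡ 0ℚ
  w₁₁≡0 = subst (λ k → w N₁ k ≡ 0ℚ) nid₁ (w-self valid₁)

  τ₀≤nextPot : ∀ {o p} i → 0ℚ ≤ p → i 2 ≡ true → τ N₀ ≤ nextPot (withState N₀ o p) i 4
  τ₀≤nextPot {o} {p} i 0≤p i₂ = begin
    τ N₀                                ≤⟨ τ₀≤w₀₁+w₀₂ ⟩
    w N₀ 1 + w N₀ 2                     ≤⟨ +-monoˡ-≤ (w N₀ 2) (weight≤contribution (w N₀) i 1 w₀₁≤0) ⟩
    contribution (w N₀) i 1 + w N₀ 2    ≡⟨ cong (contribution (w N₀) i 1 +_) (contribution-on (w N₀) i 2 i₂) ⟨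
    contribution (w N₀) i 1 + contribution (w N₀) i 2
      ≡⟨ potential₄-inner (w N₀) i (contribution-silent (w N₀) i 0 w₀₀≡0) (contribution-silent (w N₀) i 3 w₀₃≡0) ⟨
    potential (w N₀) i 4                ≤⟨ potential≤nextPot (withState N₀ o p) i 4 (lk-lower valid₀) 0≤p ⟩
    nextPot (withState N₀ o p) i 4      ∎
    where open ≤-Reasoning

  N₁-potential : ∀ i (b : Bool) → i 0 ≡ b → i 3 ≡ true →
    potential (w N₁) i 4 ≡ (if b then w N₁ 0 else 0ℚ) + w N₁ 3
  N₁-potential i b i₀ i₃ = trans
    (potential₄-outer (w N₁) i (contribution-silent (w N₁) i 1 w₁₁≡0) (contribution-silent (w N₁) i 2 w₁₂≡0))
    (cong₂ _+_ (cong (λ b → if b then w N₁ 0 else 0ℚ) i₀) (contribution-on (w N₁) i 3 i₃))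

  Potential₁ : ℕ → ℚ → Set
  Potential₁ zero          p = 0ℚ ≤ p
  Potential₁ (suc zero)    p = τ N₁ ≤ p
  Potential₁ (suc (suc _)) p = p ≤ 0ℚ

  Potential₁-next : ∀ n {o p} i → Potential₁ n p → i 0 ≡ headB (firesAlways n) → i 3 ≡ true →
    Potential₁ (suc n) (nextPot (withState N₁ o p) i 4)
  Potential₁-next zero {o} {p} i 0≤p i₀ i₃ = begin
    τ N₁                             ≤⟨ τ₁≤w₁₃ ⟩
    w N₁ 3                           ≡⟨ trans (N₁-potential i false i₀ i₃) (+-identityˡ (w N₁ 3)) ⟨
    potential (w N₁) i 4             ≤⟨ potential≤nextPot (withState N₁ o p) i 4 (lk-lower valid₁) 0≤p ⟩
    nextPot (withState N₁ o p) i 4   ∎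
    where open ≤-Reasoning
  Potential₁-next (suc zero) {o} {p} i τ₁≤p i₀ i₃ = begin
    nextPot (withState N₁ o p) i 4   ≡⟨ nextPot-fired (withState N₁ o p) i 4 τ₁≤p ⟩
    potential (w N₁) i 4             ≡⟨ N₁-potential i true i₀ i₃ ⟩
    w N₁ 0 + w N₁ 3                  ≤⟨ w₁₀+w₁₃≤0 ⟩
    0ℚ                               ∎
    where open ≤-Reasoning
  Potential₁-next (suc (suc n)) {o} {p} i p≤0 i₀ i₃ = begin
    nextPot (withState N₁ o p) i 4   ≤⟨ nextPot≤potential (withState N₁ o p) i 4 (lk-lower valid₁) p≤0 ⟩
    potential (w N₁) i 4             ≡⟨ N₁-potential i true i₀ i₃ ⟩
    w N₁ 0 + w N₁ 3                  ≤⟨ w₁₀+w₁₃≤0 ⟩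
    0ℚ                               ∎
    where open ≤-Reasoning

  Potential₁-output : ∀ n {p} → Potential₁ (suc n) p → (τ N₁ ≤ᵇ p) ∷ firesOnce n ≡ firesOnce (suc n)
  Potential₁-output zero    τ₁≤p = cong (_∷ firesOnce 0) (≤⇒≤ᵇ≡true τ₁≤p)
  Potential₁-output (suc n) p≤0  = cong (_∷ firesOnce (suc n)) (>⇒≤ᵇ≡false (≤-<-trans p≤0 (τ-pos valid₁)))

  record AfterSteps (n : ℕ) (C : Circuit) : Set where
    field
      pot₀ pot₁   : ℚ
      find₀       : findNeuron 0 (ln C) ≡ just (withState N₀ (firesAlways n) pot₀)
      find₁       : findNeuron 1 (ln C) ≡ just (withState N₁ (firesOnce n) pot₁)
      0≤pot₀      : 0ℚ ≤ pot₀
      pot₁-phase  : Potential₁ n pot₁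

  afterSteps-initial : ∀ {C} → findNeuron 0 (ln C) ≡ just N₀ → findNeuron 1 (ln C) ≡ just N₁ →
    InitialNeuron N₀ → InitialNeuron N₁ → AfterSteps 0 C
  -- By record η, N₀ is definitionally withState N₀ (output N₀) (curPot N₀).
  afterSteps-initial found₀ found₁ (out₀ , pot₀≡0) (out₁ , pot₁≡0) = record
    { pot₀       = 0ℚ
    ; pot₁       = 0ℚ
    ; find₀      = trans found₀ (cong₂ (λ o p → just (withState N₀ o p)) out₀ pot₀≡0)
    ; find₁      = trans found₁ (cong₂ (λ o p → just (withState N₁ o p)) out₁ pot₁≡0)
    ; 0≤pot₀     = ≤-refl
    ; pot₁-phase = ≤-refl
    }

  afterSteps-step : ∀ {n C e} → length (ln C) ≡ 2 → si C ≡ 2 → e 2 ≡ true → e 3 ≡ true →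
    AfterSteps n C → AfterSteps (suc n) (circuitStep C e)
  afterSteps-step {n} {C} {e} len≡2 si≡2 e₂ e₃ s = record
    { pot₀       = pot₀′
    ; pot₁       = pot₁′
    ; find₀      = trans (findNeuron-circuitStep C e envSize≡4 find₀)
                     (cong (λ b → just (withState N₀ (b ∷ firesAlways n) pot₀′)) (≤⇒≤ᵇ≡true τ₀≤pot₀′))
    ; find₁      = trans (findNeuron-circuitStep C e envSize≡4 find₁)
                     (cong (λ o → just (withState N₁ o pot₁′)) (Potential₁-output n phase₁′))
    ; 0≤pot₀     = <⇒≤ (<-≤-trans (τ-pos valid₀) τ₀≤pot₀′)
    ; pot₁-phase = phase₁′
    }
    where
    open AfterSteps s
    i : InputFn
    i = circuitInput C e
    pot₀′ pot₁′ : ℚ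
    pot₀′ = nextPot (withState N₀ (firesAlways n) pot₀) i 4
    pot₁′ = nextPot (withState N₁ (firesOnce n) pot₁) i 4
    envSize≡4 : length (ln C) ℕ.+ si C ≡ 4
    envSize≡4 = cong₂ ℕ._+_ len≡2 si≡2
    i₀ : i 0 ≡ headB (firesAlways n)
    i₀ = circuitInput-neuron C e (subst (0 ℕ.<_) (sym len≡2) ℕ.z<s) find₀
    fromSource : ∀ {x} → 2 ℕ.≤ x → i x ≡ e x
    fromSource 2≤x = circuitInput-source C e (subst (ℕ._≤ _) (sym len≡2) 2≤x)
    τ₀≤pot₀′ : τ N₀ ≤ pot₀′
    τ₀≤pot₀′ = τ₀≤nextPot {firesAlways n} i 0≤pot₀ (trans (fromSource ℕ.≤-refl) e₂)
    phase₁′ : Potential₁ (suc n) pot₁′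
    phase₁′ = Potential₁-next n {firesOnce n} i pot₁-phase i₀ (trans (fromSource (ℕ.n≤1+n 2)) e₃)

  afterSteps-run : ∀ NC → length (ln NC) ≡ 2 → si NC ≡ 2 → AfterSteps 0 NC →
    ∀ inp → All (λ b → (b 2 ≡ true) × (b 3 ≡ true)) inp → AfterSteps (length inp) (run NC inp)
  afterSteps-run NC len≡2 si≡2 initial []       []                    = initial
  afterSteps-run NC len≡2 si≡2 initial (e ∷ es) ((e₂ , e₃) ∷ sources) =
    afterSteps-step (trans (length-ln-run NC es) len≡2) (trans (si-run NC es) si≡2) e₂ e₃
      (afterSteps-run NC len≡2 si≡2 initial es sources)

contraInhib-weights : ∀ {NC N₀ N₁} → ContraInhib NC →
  findNeuron 0 (ln NC) ≡ just N₀ → findNeuron 1 (ln NC) ≡ just N₁ →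
  w N₀ 1 < 0ℚ × w N₀ 3 ≡ 0ℚ × w N₁ 2 ≡ 0ℚ
contraInhib-weights (_ , _ , (_ , found₀′ , w₀₁<0 , _ , w₀₃≡0) , (_ , found₁′ , _ , w₁₂≡0 , _)) found₀ found₁
  with just-injective (trans (sym found₀′) found₀) | just-injective (trans (sym found₁′) found₁)
... | refl | refl = w₀₁<0 , w₀₃≡0 , w₁₂≡0

proposition6p8 : (NC : Circuit) → ValidCircuit NC → InitialCircuit NC → ContraInhib NC →
    (N₀ N₁ : Neuron) → findNeuron 0 (ln NC) ≡ just N₀ → findNeuron 1 (ln NC) ≡ just N₁ →
    (inp : List InputFn) → All (λ b → (b 2 ≡ true) × (b 3 ≡ true)) inp →
    τ N₀ ≤ w N₀ 1 + w N₀ 2 → τ N₁ ≤ w N₁ 3 → w N₁ 0 + w N₁ 3 ≤ 0ℚ →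
    (outputOf NC 0 inp ≡ repeat true (length inp) ++ (false ∷ [])) Data.Product.×
    (length inp ≡ 0 → outputOf NC 1 inp ≡ false ∷ []) ×
    (length inp ≢ 0 →
      outputOf NC 1 inp ≡ repeat false (length inp ∸ 1) ++ (true ∷ false ∷ []))
proposition6p8 NC valid initial contra@(si≡2 , len≡2 , _) N₀ N₁ found₀ found₁ inp sources
  τ₀≤w₀₁+w₀₂ τ₁≤w₁₃ w₁₀+w₁₃≤0 with contraInhib-weights {NC} contra found₀ found₁
... | w₀₁<0 , w₀₃≡0 , w₁₂≡0 =
    cong (maybe output []) find₀ ,
    (λ n≡0 → trans (cong (maybe output []) find₁) (cong firesOnce n≡0)) ,
    (λ n≢0 → trans (cong (maybe output []) find₁) (firesOnce-nonzero (length inp) n≢0))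
  where
  lookupFound : ∀ {P : Neuron → Set} {x N} → All P (ln NC) → findNeuron x (ln NC) ≡ just N → P N
  lookupFound ps found = lookup ps (findNeuron-∈ (ln NC) found)
  open ValidCircuit valid
  open ContraInhibition N₀ N₁ (lookupFound neurons-valid found₀) (lookupFound neurons-valid found₁)
    (findNeuron-nid (ln NC) found₀) (findNeuron-nid (ln NC) found₁)
    (<⇒≤ w₀₁<0) w₀₃≡0 w₁₂≡0
    τ₀≤w₀₁+w₀₂ τ₁≤w₁₃ w₁₀+w₁₃≤0
  open AfterSteps (afterSteps-run NC len≡2 si≡2
    (afterSteps-initial found₀ found₁ (lookupFound initial found₀) (lookupFound initial found₁)) inp sources)
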